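{- Let $PV:\mathcal{F}\times\mathcal{F}_0\to\mathbb{R}_{\ge0}$ be a Coxian plausible value. Let $A,B\in\mathcal{F}$ with $A.B=0$, and let $C\in\mathcal{F}_0$. Then $PV(A+B|C)=PV(A|C)+PV(B|C)$.
   Context: Random quantities: $\mathcal{T}$ is a unital associative commutative algebra over $\mathbb{R}$; reals $r$ are identified with $r\mathbf{1}$; products are written $X.Y$. Events: idempotents $A$ ($A.A=A$). $\mathcal{E}(\mathcal{T})$ is the set of events; negation is $1-A$ and conjunction is $A.B$. Coxian plausible value: a function $PV:\mathcal{F}\times\mathcal{F}_0\to\mathbb{R}_{\ge0}$, written $PV(A|C)$, where $\mathcal{F}$ is a nonempty subset of $\mathcal{E}(\mathcal{T})$ closed under negation and conjunction and $\mathcal{F}_0=\mathcal{F}\setminus\{0\}$, such that - $PV(C|C)>0$ for $C\in\mathcal{F}_0$; - $PV(1-A|C)=1-PV(A|C)$ for $A\in\mathcal{F}$ and $C\in\mathcal{F}_0$; - $PV(A.C|D)=PV(A|C.D)\,PV(C|D)$ for $A,C,D\in\mathcal{F}$ with $C.D\neq0$. -}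

module Defs where

open import Level using (Level; suc; _⊔_) renaming (zero to 0ℓ)
open import Data.Product using (Σ; ∃; _×_; _,_)
open import Data.Sum using (_⊎_)
open import Relation.Binary.PropositionalEquality using (_≡_; _≢_)
open import Algebra.Structures using (IsCommutativeRing)
open import Algebra.Morphism.Structures using (IsRingHomomorphism)

-- The real numbers, given axiomatically as a Dedekind-complete ordered field
-- (this characterises ℝ up to unique isomorphism).  Equality is propositional.
record RealNumbers : Set₁ where
  infixl 6 _+_ _-_
  infixl 7 _*_
  infix 4 _≤_ _<_
  field
    ℝ : Set
    _+_ _*_ : ℝ → ℝ → ℝ
    -_ : ℝ → ℝ
    0ℝ 1ℝ : ℝ
    isCommutativeRing : IsCommutativeRing _≡_ _+_ _*_ -_ 0ℝ 1ℝ
    0≢1 : 0ℝ ≢ 1ℝ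
    inverse : ∀ x → x ≢ 0ℝ → Σ ℝ λ y → x * y ≡ 1ℝ
    _≤_ : ℝ → ℝ → Set
    ≤-refl : ∀ x → x ≤ x
    ≤-antisym : ∀ {x y} → x ≤ y → y ≤ x → x ≡ y
    ≤-trans : ∀ {x y z} → x ≤ y → y ≤ z → x ≤ z
    ≤-total : ∀ x y → x ≤ y ⊎ y ≤ x
    +-mono-≤ : ∀ {x y} z → x ≤ y → x + z ≤ y + z
    *-nonneg : ∀ {x y} → 0ℝ ≤ x → 0ℝ ≤ y → 0ℝ ≤ x * y
    complete : (S : ℝ → Set) → (Σ ℝ S) → (Σ ℝ λ b → ∀ x → S x → x ≤ b) →
               Σ ℝ λ s → (∀ x → S x → x ≤ s) ×
                         (∀ b → (∀ x → S x → x ≤ b) → s ≤ b)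

  _-_ : ℝ → ℝ → ℝ
  x - y = x + (- y)

  _<_ : ℝ → ℝ → Set
  x < y = (x ≤ y) × (x ≢ y)

record CommAlgebra (R : RealNumbers) : Set₁ where
  open RealNumbers R using (ℝ) renaming (_+_ to _+ᴿ_; _*_ to _*ᴿ_; -_ to -ᴿ_; 0ℝ to 0ᴿ; 1ℝ to 1ᴿ)
  infixl 6 _+_ _-_
  infixl 7 _·_
  field
    𝒯 : Set
    _+_ _·_ : 𝒯 → 𝒯 → 𝒯
    -_ : 𝒯 → 𝒯
    𝟘 𝟙 : 𝒯
    isCommutativeRing : IsCommutativeRing _≡_ _+_ _·_ -_ 𝟘 𝟙
    ι : ℝ → 𝒯
    ι-isRingHom : IsRingHomomorphism
                    (record { Carrier = ℝ ; _≈_ = _≡_ ; _+_ = _+ᴿ_ ; _*_ = _*ᴿ_ ; -_ = -ᴿ_ ; 0# = 0ᴿ ; 1# = 1ᴿ })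
                    (record { Carrier = 𝒯 ; _≈_ = _≡_ ; _+_ = _+_ ; _*_ = _·_ ; -_ = -_ ; 0# = 𝟘 ; 1# = 𝟙 })
                    ι

  _-_ : 𝒯 → 𝒯 → 𝒯
  X - Y = X + (- Y)

  IsEvent : 𝒯 → Set
  IsEvent A = A · A ≡ A

-- A Coxian plausible value on a family ℱ of events.
-- ℱ is a predicate on 𝒯; ℱ₀ = ℱ ∖ {0} is expressed by an extra proof C ≢ 0.
-- Membership proofs are irrelevant arguments, so PV is a genuine function on ℱ × ℱ₀.
record CoxianPV (R : RealNumbers) (T : CommAlgebra R) : Set₁ where
  open RealNumbers R using (ℝ; 0ℝ; 1ℝ; _≤_; _<_) renaming (_*_ to _*ᴿ_; _-_ to _-ᴿ_)
  open CommAlgebra T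
  field
    ℱ : 𝒯 → Set
    ℱ-nonempty : Σ 𝒯 ℱ
    ℱ-events : ∀ {A} → ℱ A → IsEvent A
    ℱ-neg : ∀ {A} → ℱ A → ℱ (𝟙 - A)
    ℱ-conj : ∀ {A B} → ℱ A → ℱ B → ℱ (A · B)
    PV : (A C : 𝒯) → .(ℱ A) → .(ℱ C) → .(C ≢ 𝟘) → ℝ
    PV-nonneg : ∀ A C (a : ℱ A) (c : ℱ C) (c≢0 : C ≢ 𝟘) → 0ℝ ≤ PV A C a c c≢0
    PV-self : ∀ C (c : ℱ C) (c≢0 : C ≢ 𝟘) → 0ℝ < PV C C c c c≢0
    PV-neg : ∀ A C (a : ℱ A) (c : ℱ C) (c≢0 : C ≢ 𝟘) →
             PV (𝟙 - A) C (ℱ-neg a) c c≢0 ≡ 1ℝ -ᴿ PV A C a c c≢0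
    PV-prod : ∀ A C D (a : ℱ A) (c : ℱ C) (d : ℱ D) (cd≢0 : C · D ≢ 𝟘) (d≢0 : D ≢ 𝟘) →
              PV (A · C) D (ℱ-conj a c) d d≢0 ≡
                PV A (C · D) a (ℱ-conj c d) cd≢0 *ᴿ PV C D c d d≢0

-- Since A.B = 0, the event A + B is the negation of (1 - A).(1 - B), so by the
-- negation and product rules PV(A + B|C) = 1 - (1 - PV(A|D)) PV(1 - B|C) with
-- D = (1 - B).C, while the product rule gives PV(A|D) PV(1 - B|C) = PV(A.(1 - B)|C)
-- = PV(A|C); this needs D ≠ 0.  If D = 0 we argue with the roles of A and B
-- swapped, because (1 - B).C and (1 - A).C cannot both vanish when C ≠ 0.  That
-- disjunction is not constructive; it follows from the order completeness of ℝ.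
module Submission where

open import Defs
open import Algebra.Bundles using (CommutativeRing)
open import Data.Empty using (⊥-elim)
open import Data.Product using (Σ; _×_; _,_; swap)
open import Data.Sum using (_⊎_; inj₁; inj₂)
open import Function using (_∘_)
open import Relation.Binary.PropositionalEquality
  using (_≡_; _≢_; refl; sym; trans; cong; subst; subst₂; cong₂; module ≡-Reasoning)
open import Relation.Nullary using (¬_)

module CommutativeRingProperties {c ℓ} (R : CommutativeRing c ℓ) where
  open CommutativeRing R
  open import Algebra.Properties.Ring ring
  open import Relation.Binary.Reasoning.Setoid setoid

  x-[x-y]≈y : ∀ x y → x - (x - y) ≈ y
  x-[x-y]≈y x y = begin
    x - (x - y)   ≈⟨ +-congˡ (⁻¹-anti-homo‿- x y) ⟩
    x + (y - x)   ≈⟨ +-assoc x y (- x) ⟨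
    x + y - x     ≈⟨ xyx⁻¹≈y x y ⟩
    y             ∎

  x-[y-z]≈x-y+z : ∀ x y z → x - (y - z) ≈ x - y + z
  x-[y-z]≈x-y+z x y z = begin
    x - (y - z)   ≈⟨ +-congˡ (⁻¹-anti-homo‿- y z) ⟩
    x + (z - y)   ≈⟨ +-congˡ (+-comm z (- y)) ⟩
    x + (- y + z) ≈⟨ +-assoc x (- y) z ⟨
    x - y + z     ∎

  1-[1-x]*[1-y]≈y+x*[1-y] : ∀ x y → 1# - (1# - x) * (1# - y) ≈ y + x * (1# - y)
  1-[1-x]*[1-y]≈y+x*[1-y] x y = begin
    1# - (1# - x) * (1# - y)                ≈⟨ +-congˡ (-‿cong ([y-z]x≈yx-zx (1# - y) 1# x)) ⟩
    1# - (1# * (1# - y) - x * (1# - y))     ≈⟨ +-congˡ (-‿cong (+-congʳ (*-identityˡ (1# - y)))) ⟩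
    1# - ((1# - y) - x * (1# - y))          ≈⟨ x-[y-z]≈x-y+z 1# (1# - y) (x * (1# - y)) ⟩
    1# - (1# - y) + x * (1# - y)            ≈⟨ +-congʳ (x-[x-y]≈y 1# y) ⟩
    y + x * (1# - y)                        ∎

  x*y≈0⇒x*[1-y]≈x : ∀ {x y} → x * y ≈ 0# → x * (1# - y) ≈ x
  x*y≈0⇒x*[1-y]≈x {x} {y} xy≈0 = begin
    x * (1# - y)    ≈⟨ x[y-z]≈xy-xz x 1# y ⟩
    x * 1# - x * y  ≈⟨ +-cong (*-identityʳ x) (-‿cong xy≈0) ⟩
    x - 0#          ≈⟨ +-congˡ -0#≈0# ⟩
    x + 0#          ≈⟨ +-identityʳ x ⟩
    x               ∎

  x*y≈0⇒x+y≈1-[1-x]*[1-y] : ∀ {x y} → x * y ≈ 0# → x + y ≈ 1# - (1# - x) * (1# - y)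
  x*y≈0⇒x+y≈1-[1-x]*[1-y] {x} {y} xy≈0 = begin
    x + y                     ≈⟨ +-comm x y ⟩
    y + x                     ≈⟨ +-congˡ (x*y≈0⇒x*[1-y]≈x xy≈0) ⟨
    y + x * (1# - y)          ≈⟨ 1-[1-x]*[1-y]≈y+x*[1-y] x y ⟨
    1# - (1# - x) * (1# - y)  ∎

  [1-x]*y≈0⇒y≈x*y : ∀ {x y} → (1# - x) * y ≈ 0# → y ≈ x * y
  [1-x]*y≈0⇒y≈x*y {x} {y} [1-x]y≈0 = x∙y⁻¹≈ε⇒x≈y y (x * y) (begin
    y - x * y           ≈⟨ +-congʳ (*-identityˡ y) ⟨
    1# * y - x * y      ≈⟨ [y-z]x≈yx-zx y 1# x ⟨
    (1# - x) * y        ≈⟨ [1-x]y≈0 ⟩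
    0#                  ∎)

  x*y≈0⇒[1-x]*z≈0⇒[1-y]*z≈0⇒z≈0 : ∀ {x y z} → x * y ≈ 0# →
    (1# - x) * z ≈ 0# → (1# - y) * z ≈ 0# → z ≈ 0#
  x*y≈0⇒[1-x]*z≈0⇒[1-y]*z≈0⇒z≈0 {x} {y} {z} xy≈0 [1-x]z≈0 [1-y]z≈0 = begin
    z            ≈⟨ [1-x]*y≈0⇒y≈x*y [1-x]z≈0 ⟩
    x * z        ≈⟨ *-congˡ ([1-x]*y≈0⇒y≈x*y [1-y]z≈0) ⟩
    x * (y * z)  ≈⟨ *-assoc x y z ⟨
    x * y * z    ≈⟨ *-congʳ xy≈0 ⟩
    0# * z       ≈⟨ zeroˡ z ⟩
    0#           ∎

module RealNumbersProperties (ℝ-structure : RealNumbers) where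
  open RealNumbers ℝ-structure

  ℝ-commutativeRing : CommutativeRing _ _
  ℝ-commutativeRing = record { isCommutativeRing = isCommutativeRing }

  open CommutativeRing ℝ-commutativeRing using (-‿inverseʳ; +-identityˡ; ring)
  open import Algebra.Properties.Ring ring using (-1*x≈-x; -‿involutive)

  0≤1 : 0ℝ ≤ 1ℝ
  0≤1 with ≤-total 0ℝ 1ℝ
  ... | inj₁ 0≤1 = 0≤1
  ... | inj₂ 1≤0 = subst (0ℝ ≤_) [-1]*[-1]≡1 (*-nonneg 0≤-1 0≤-1)
    where
    0≤-1 : 0ℝ ≤ - 1ℝ
    0≤-1 = subst₂ _≤_ (-‿inverseʳ 1ℝ) (+-identityˡ (- 1ℝ)) (+-mono-≤ (- 1ℝ) 1≤0)
    [-1]*[-1]≡1 : - 1ℝ * - 1ℝ ≡ 1ℝ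
    [-1]*[-1]≡1 = trans (-1*x≈-x (- 1ℝ)) (-‿involutive 1ℝ)

  1≰0 : ¬ 1ℝ ≤ 0ℝ
  1≰0 1≤0 = 0≢1 (≤-antisym 0≤1 1≤0)

  0-or-1-if : Set → ℝ → Set
  0-or-1-if Q x = x ≡ 0ℝ ⊎ (x ≡ 1ℝ × Q)

  0-or-1-if-bounded : ∀ {Q b} → 0ℝ ≤ b → (Q → 1ℝ ≤ b) → ∀ x → 0-or-1-if Q x → x ≤ b
  0-or-1-if-bounded 0≤b q⇒1≤b x (inj₁ refl)       = 0≤b
  0-or-1-if-bounded 0≤b q⇒1≤b x (inj₂ (refl , q)) = q⇒1≤b q

  -- The supremum of {0} ∪ {1 | Q} decides Q as far as order comparisons go.
  indicator : (Q : Set) → Σ ℝ λ s → (Q → 1ℝ ≤ s) × (¬ Q → s ≤ 0ℝ)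
  indicator Q
    with complete (0-or-1-if Q) (0ℝ , inj₁ refl) (1ℝ , 0-or-1-if-bounded 0≤1 λ _ → ≤-refl 1ℝ)
  ... | s , upper , least =
    s , (λ q → upper 1ℝ (inj₂ (refl , q)))
      , (λ ¬q → least 0ℝ (0-or-1-if-bounded (≤-refl 0ℝ) (⊥-elim ∘ ¬q)))

  refute-first : ∀ {P Q : Set} {s t} → (P → 1ℝ ≤ s) → (¬ Q → t ≤ 0ℝ) → s ≤ t →
                 ¬ (P × Q) → ¬ P
  refute-first p⇒1≤s ¬q⇒t≤0 s≤t ¬pq p =
    1≰0 (≤-trans (p⇒1≤s p) (≤-trans s≤t (¬q⇒t≤0 λ q → ¬pq (p , q))))

  ¬×⇒¬⊎¬ : (Q₁ Q₂ : Set) → ¬ (Q₁ × Q₂) → ¬ Q₁ ⊎ ¬ Q₂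
  ¬×⇒¬⊎¬ Q₁ Q₂ ¬q₁q₂ with indicator Q₁ | indicator Q₂
  ... | s₁ , q₁⇒1≤s₁ , ¬q₁⇒s₁≤0 | s₂ , q₂⇒1≤s₂ , ¬q₂⇒s₂≤0 with ≤-total s₁ s₂
  ... | inj₁ s₁≤s₂ = inj₁ (refute-first q₁⇒1≤s₁ ¬q₂⇒s₂≤0 s₁≤s₂ ¬q₁q₂)
  ... | inj₂ s₂≤s₁ = inj₂ (refute-first q₂⇒1≤s₂ ¬q₁⇒s₁≤0 s₂≤s₁ (¬q₁q₂ ∘ swap))

module CoxianPVProperties {ℝ-structure : RealNumbers} {T : CommAlgebra ℝ-structure}
                          (P : CoxianPV ℝ-structure T) where
  open RealNumbers ℝ-structure using (1ℝ) renaming (_+_ to _+ᴿ_; _*_ to _*ᴿ_; _-_ to _-ᴿ_)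
  open RealNumbersProperties ℝ-structure using (ℝ-commutativeRing; ¬×⇒¬⊎¬)
  open CommAlgebra T
  open CoxianPV P
  open CommutativeRing ℝ-commutativeRing using () renaming (+-comm to +ᴿ-comm)
  open CommutativeRingProperties ℝ-commutativeRing using (1-[1-x]*[1-y]≈y+x*[1-y])

  𝒯-commutativeRing : CommutativeRing _ _
  𝒯-commutativeRing = record { isCommutativeRing = isCommutativeRing }

  open CommutativeRingProperties 𝒯-commutativeRing
    using (x*y≈0⇒x*[1-y]≈x; x*y≈0⇒x+y≈1-[1-x]*[1-y]; x*y≈0⇒[1-x]*z≈0⇒[1-y]*z≈0⇒z≈0)
  open CommutativeRing 𝒯-commutativeRing using (+-comm; *-comm)
  open ≡-Reasoning

  PV-cong : ∀ {X Y C} → X ≡ Y → (x : ℱ X) (y : ℱ Y) (c : ℱ C) (c≢0 : C ≢ 𝟘) →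
            PV X C x c c≢0 ≡ PV Y C y c c≢0
  PV-cong refl _ _ _ _ = refl

  PV-disjoint-sum-given-[1-B]·C≢0 :
    ∀ A B C (a : ℱ A) (b : ℱ B) (c : ℱ C) (c≢0 : C ≢ 𝟘) → A · B ≡ 𝟘 →
    (ab : ℱ (A + B)) → (d≢0 : (𝟙 - B) · C ≢ 𝟘) →
    PV (A + B) C ab c c≢0 ≡ PV A C a c c≢0 +ᴿ PV B C b c c≢0
  PV-disjoint-sum-given-[1-B]·C≢0 A B C a b c c≢0 A·B≡0 ab d≢0 = begin
    PV (A + B) C ab c c≢0
      ≡⟨ PV-cong (x*y≈0⇒x+y≈1-[1-x]*[1-y] A·B≡0) ab (ℱ-neg a'b') c c≢0 ⟩
    PV (𝟙 - (𝟙 - A) · (𝟙 - B)) C (ℱ-neg a'b') c c≢0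
      ≡⟨ PV-neg ((𝟙 - A) · (𝟙 - B)) C a'b' c c≢0 ⟩
    1ℝ -ᴿ PV ((𝟙 - A) · (𝟙 - B)) C a'b' c c≢0
      ≡⟨ cong (1ℝ -ᴿ_) (PV-prod (𝟙 - A) (𝟙 - B) C a' b' c d≢0 c≢0) ⟩
    1ℝ -ᴿ PV (𝟙 - A) D a' d d≢0 *ᴿ PV (𝟙 - B) C b' c c≢0
      ≡⟨ cong₂ (λ p q → 1ℝ -ᴿ p *ᴿ q) (PV-neg A D a d d≢0) (PV-neg B C b c c≢0) ⟩
    1ℝ -ᴿ (1ℝ -ᴿ PV A D a d d≢0) *ᴿ (1ℝ -ᴿ PV B C b c c≢0)
      ≡⟨ 1-[1-x]*[1-y]≈y+x*[1-y] (PV A D a d d≢0) (PV B C b c c≢0) ⟩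
    PV B C b c c≢0 +ᴿ PV A D a d d≢0 *ᴿ (1ℝ -ᴿ PV B C b c c≢0)
      ≡⟨ cong (λ q → PV B C b c c≢0 +ᴿ PV A D a d d≢0 *ᴿ q) (sym (PV-neg B C b c c≢0)) ⟩
    PV B C b c c≢0 +ᴿ PV A D a d d≢0 *ᴿ PV (𝟙 - B) C b' c c≢0
      ≡⟨ cong (PV B C b c c≢0 +ᴿ_) (sym (PV-prod A (𝟙 - B) C a b' c d≢0 c≢0)) ⟩
    PV B C b c c≢0 +ᴿ PV (A · (𝟙 - B)) C (ℱ-conj a b') c c≢0
      ≡⟨ cong (PV B C b c c≢0 +ᴿ_) (PV-cong (x*y≈0⇒x*[1-y]≈x A·B≡0) (ℱ-conj a b') a c c≢0) ⟩
    PV B C b c c≢0 +ᴿ PV A C a c c≢0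
      ≡⟨ +ᴿ-comm (PV B C b c c≢0) (PV A C a c c≢0) ⟩
    PV A C a c c≢0 +ᴿ PV B C b c c≢0
      ∎
    where
    a' = ℱ-neg a
    b' = ℱ-neg b
    a'b' = ℱ-conj a' b'
    D = (𝟙 - B) · C
    d = ℱ-conj b' c

  PV-disjoint-sum : ∀ A B C (a : ℱ A) (b : ℱ B) (c : ℱ C) (c≢0 : C ≢ 𝟘) → A · B ≡ 𝟘 →
                    (ab : ℱ (A + B)) →
                    PV (A + B) C ab c c≢0 ≡ PV A C a c c≢0 +ᴿ PV B C b c c≢0
  PV-disjoint-sum A B C a b c c≢0 A·B≡0 ab
    with ¬×⇒¬⊎¬ ((𝟙 - B) · C ≡ 𝟘) ((𝟙 - A) · C ≡ 𝟘)
                (λ (b'c≡0 , a'c≡0) → c≢0 (x*y≈0⇒[1-x]*z≈0⇒[1-y]*z≈0⇒z≈0 A·B≡0 a'c≡0 b'c≡0))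
  ... | inj₁ b'c≢0 = PV-disjoint-sum-given-[1-B]·C≢0 A B C a b c c≢0 A·B≡0 ab b'c≢0
  ... | inj₂ a'c≢0 = begin
    PV (A + B) C ab c c≢0           ≡⟨ PV-cong (+-comm A B) ab ba c c≢0 ⟩
    PV (B + A) C ba c c≢0           ≡⟨ PV-disjoint-sum-given-[1-B]·C≢0 B A C b a c c≢0 B·A≡0 ba a'c≢0 ⟩
    PV B C b c c≢0 +ᴿ PV A C a c c≢0 ≡⟨ +ᴿ-comm _ _ ⟩
    PV A C a c c≢0 +ᴿ PV B C b c c≢0 ∎
    where
    ba = subst ℱ (+-comm A B) ab
    B·A≡0 = trans (*-comm B A) A·B≡0

mainTheorem15 : (R : RealNumbers) (T : CommAlgebra R) (P : CoxianPV R T) →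
    let open RealNumbers R using () renaming (_+_ to _+ᴿ_) in
    let open CommAlgebra T in
    let open CoxianPV P in
    ∀ A B C (a : ℱ A) (b : ℱ B) (c : ℱ C) (c≢0 : C ≢ 𝟘) → A · B ≡ 𝟘 →
    (ab : ℱ (A + B)) →
    PV (A + B) C ab c c≢0 ≡ PV A C a c c≢0 +ᴿ PV B C b c c≢0
mainTheorem15 R T P = CoxianPVProperties.PV-disjoint-sum P
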